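{- Let $k\ge3$ and let $t=a^kb$ ($k$ copies of $a$ followed by one $b$, with $a\ne b$). Then every finite simple graph is $t$-representable.
   Context: Two words are isomorphic if one is obtained from the other by a bijective renaming of letters. For a word $w$ and letters $x,y$, $w|_{xy}$ denotes the subword of $w$ consisting of all occurrences of $x$ and $y$ (in order). A word $u$ over the two letters $\{a,b\}$ occurs in $w|_{xy}$ ($x\neq y$) if some contiguous factor of $w|_{xy}$ is isomorphic to $u$; otherwise $w|_{xy}$ avoids $u$. For a word $t$ on two letters, a graph $G=(V,E)$ is $t$-representable if there is a word $w$ over the alphabet $V$ containing each letter of $V$ at least once such that for all distinct $x,y\in V$, $xy\in E$ if and only if $w|_{xy}$ avoids $t$. -}

module Defs where

open import Data.Nat using (ℕ)
open import Data.Bool using (Bool; true; false)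
open import Data.Fin using (Fin)
open import Data.Fin.Properties using (_≟_)
open import Data.List using (List; []; _∷_; _++_; map)
open import Data.List.Membership.Propositional using (_∈_)
open import Data.Product using (Σ; ∃; _×_)
open import Relation.Nullary using (¬_; yes; no)
open import Relation.Binary.PropositionalEquality using (_≡_; _≢_)
open import Function.Bundles using (_⇔_)

record SimpleGraph (n : ℕ) : Set where
  field
    Adj   : Fin n → Fin n → Bool
    sym   : ∀ x y → Adj x y ≡ Adj y x
    irrefl : ∀ x → Adj x x ≡ false

-- Two words are isomorphic if one is obtained from the other by a
-- bijective renaming of letters: a renaming f with map f u ≡ v that is
-- injective on the letters of u (it is automatically onto the letters of v).
Isomorphic : {A B : Set} → List A → List B → Set
Isomorphic {A} {B} u v =
  Σ (A → B) λ f → (map f u ≡ v) × (∀ c d → c ∈ u → d ∈ u → f c ≡ f d → c ≡ d)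

Occurs : {A B : Set} → List A → List B → Set
Occurs {B = B} u v =
  Σ (List B) λ p → Σ (List B) λ m → Σ (List B) λ s → (v ≡ p ++ m ++ s) × Isomorphic u m

Avoids : {A B : Set} → List B → List A → Set
Avoids v u = ¬ Occurs u v

restrict : {n : ℕ} → List (Fin n) → Fin n → Fin n → List (Fin n)
restrict [] x y = []
restrict (c ∷ w) x y with c ≟ x | c ≟ y
... | yes _ | _     = c ∷ restrict w x y
... | no _  | yes _ = c ∷ restrict w x y
... | no _  | no _  = restrict w x y

Representable : List Bool → {n : ℕ} → SimpleGraph n → Set
Representable t {n} G =
  Σ (List (Fin n)) λ w →
    (∀ v → v ∈ w) ×
    (∀ x y → x ≢ y → (SimpleGraph.Adj G x y ≡ true) ⇔ Avoids (restrict w x y) t)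

-- The word a^k b, with a = false and b = true.
akb : ℕ → List Bool
akb k = Data.List.replicate k false ++ true ∷ []

module Submission where

-- Let π enumerate the vertices.  For every ordered non-edge (x, y), x ≠ y, take the block
--     B(x,y) = (π without x) · x^(k-1) · (π without x and y) · x y,
-- and let w be the concatenation of all blocks followed by π (so every vertex occurs).
-- Restricted to a pair {u,v}, the block B(u,v) becomes v u^k v, so a non-edge uv
-- yields an occurrence of a^k b.  If uv is an edge, π restricts to u v (up to the
-- order of u and v) and every block restricts to one of  u v v u,  u v u v,
-- z x^(k-1) z x  with {x,z} = {u,v}.  Avoidance is then controlled by run lengths:
-- 'Safe' tracks, left to right, that no run of k equal letters is followed by the
-- other letter; 'Robust' words (safe after any single letter) stay robust when one
-- of those short words is prefixed, which is where k ≥ 3 is used.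

open import Defs
open import Level using (0ℓ)
open import Data.Nat using (ℕ; zero; suc; _+_; _≤_; _<_; z≤n; s≤s)
open import Data.Nat.Properties using (<⇒≱; ≤-<-trans; ≤-trans; ≤-refl; +-suc; +-comm; m≤m+n)
open import Data.Bool using (Bool; true; false)
import Data.Bool.Properties as Bool
open import Data.Fin using (Fin; zero; suc)
open import Data.Fin.Properties using (_≟_; suc-injective)
open import Data.List using (List; []; _∷_; _++_; [_]; map; filter; replicate; concatMap; cartesianProduct)
open import Data.List.Properties
  using (filter-accept; filter-reject; filter-++; filter-≐; filter-none; ++-assoc; map-++; map-replicate; concatMap-++)
open import Data.List.Membership.Propositional using (_∈_)
open import Data.List.Membership.Propositional.Properties
  using (∈-map⁺; ∈-++⁺ʳ; ∈-filter⁺; ∈-filter⁻; ∈-cartesianProduct⁺; ∈-∃++)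
open import Data.List.Relation.Unary.Any using (here; there)
import Data.List.Relation.Unary.All as All
open import Data.Product using (Σ-syntax; _×_; _,_; proj₂)
open import Data.Sum using (_⊎_; inj₁; inj₂; [_,_]′)
import Data.Sum as Sum
open import Data.Empty using (⊥; ⊥-elim)
open import Function using (_∘_)
open import Function.Bundles using (_⇔_; mk⇔)
open import Relation.Nullary using (¬_; yes; no; Dec)
open import Relation.Nullary.Decidable using (_⊎-dec_; _×-dec_; ¬?)
open import Relation.Unary using (Pred; Decidable; _≐_)
open import Relation.Unary.Properties using (∅?)
open import Relation.Binary.Definitions using (DecidableEquality)
open import Relation.Binary.PropositionalEquality
  using (_≡_; _≢_; ≢-sym; refl; sym; trans; cong; cong₂; subst; subst₂; module ≡-Reasoning)
open ≡-Reasoning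

filter-comm : ∀ {A : Set} {P Q : Pred A 0ℓ} (P? : Decidable P) (Q? : Decidable Q) xs →
              filter P? (filter Q? xs) ≡ filter Q? (filter P? xs)
filter-comm P? Q? [] = refl
filter-comm {P = P} {Q} P? Q? (x ∷ xs) = by-cases (P? x) (Q? x)
  where
  ih : filter P? (filter Q? xs) ≡ filter Q? (filter P? xs)
  ih = filter-comm P? Q? xs
  by-cases : Dec (P x) → Dec (Q x) →
             filter P? (filter Q? (x ∷ xs)) ≡ filter Q? (filter P? (x ∷ xs))
  by-cases (yes p) (yes q) = begin
    filter P? (filter Q? (x ∷ xs)) ≡⟨ cong (filter P?) (filter-accept Q? q) ⟩
    filter P? (x ∷ filter Q? xs)   ≡⟨ filter-accept P? p ⟩
    x ∷ filter P? (filter Q? xs)   ≡⟨ cong (x ∷_) ih ⟩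
    x ∷ filter Q? (filter P? xs)   ≡⟨ filter-accept Q? q ⟨
    filter Q? (x ∷ filter P? xs)   ≡⟨ cong (filter Q?) (filter-accept P? p) ⟨
    filter Q? (filter P? (x ∷ xs)) ∎
  by-cases (yes p) (no ¬q) = begin
    filter P? (filter Q? (x ∷ xs)) ≡⟨ cong (filter P?) (filter-reject Q? ¬q) ⟩
    filter P? (filter Q? xs)       ≡⟨ ih ⟩
    filter Q? (filter P? xs)       ≡⟨ filter-reject Q? ¬q ⟨
    filter Q? (x ∷ filter P? xs)   ≡⟨ cong (filter Q?) (filter-accept P? p) ⟨
    filter Q? (filter P? (x ∷ xs)) ∎
  by-cases (no ¬p) (yes q) = begin
    filter P? (filter Q? (x ∷ xs)) ≡⟨ cong (filter P?) (filter-accept Q? q) ⟩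
    filter P? (x ∷ filter Q? xs)   ≡⟨ filter-reject P? ¬p ⟩
    filter P? (filter Q? xs)       ≡⟨ ih ⟩
    filter Q? (filter P? xs)       ≡⟨ cong (filter Q?) (filter-reject P? ¬p) ⟨
    filter Q? (filter P? (x ∷ xs)) ∎
  by-cases (no ¬p) (no ¬q) = begin
    filter P? (filter Q? (x ∷ xs)) ≡⟨ cong (filter P?) (filter-reject Q? ¬q) ⟩
    filter P? (filter Q? xs)       ≡⟨ ih ⟩
    filter Q? (filter P? xs)       ≡⟨ cong (filter Q?) (filter-reject P? ¬p) ⟨
    filter Q? (filter P? (x ∷ xs)) ∎

filter-map : ∀ {A B : Set} {P : Pred B 0ℓ} (P? : Decidable P) (f : A → B) xs →
             filter P? (map f xs) ≡ map f (filter (λ x → P? (f x)) xs)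
filter-map {P = P} P? f [] = refl
filter-map {P = P} P? f (x ∷ xs) = by-cases (P? (f x))
  where
  ih : filter P? (map f xs) ≡ map f (filter (λ x → P? (f x)) xs)
  ih = filter-map P? f xs
  by-cases : Dec (P (f x)) → filter P? (map f (x ∷ xs)) ≡ map f (filter (λ x → P? (f x)) (x ∷ xs))
  by-cases (yes p) = begin
    filter P? (f x ∷ map f xs)                 ≡⟨ filter-accept P? p ⟩
    f x ∷ filter P? (map f xs)                 ≡⟨ cong (f x ∷_) ih ⟩
    map f (x ∷ filter (λ x → P? (f x)) xs)     ≡⟨ cong (map f) (filter-accept (λ x → P? (f x)) p) ⟨
    map f (filter (λ x → P? (f x)) (x ∷ xs))   ∎
  by-cases (no ¬p) = begin
    filter P? (f x ∷ map f xs)                 ≡⟨ filter-reject P? ¬p ⟩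
    filter P? (map f xs)                       ≡⟨ ih ⟩
    map f (filter (λ x → P? (f x)) xs)         ≡⟨ cong (map f) (filter-reject (λ x → P? (f x)) ¬p) ⟨
    map f (filter (λ x → P? (f x)) (x ∷ xs))   ∎

module _ {n : ℕ} where
  InPair : Fin n → Fin n → Pred (Fin n) 0ℓ
  InPair x y c = c ≡ x ⊎ c ≡ y

  inPair? : ∀ x y → Decidable (InPair x y)
  inPair? x y c = c ≟ x ⊎-dec c ≟ y

  restrict-filter : ∀ w x y → restrict w x y ≡ filter (inPair? x y) w
  restrict-filter [] x y = refl
  restrict-filter (c ∷ w) x y with c ≟ x | c ≟ y
  ... | yes _ | _     = cong (c ∷_) (restrict-filter w x y)
  ... | no _  | yes _ = cong (c ∷_) (restrict-filter w x y)
  ... | no _  | no _  = restrict-filter w x y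

  restrict-++ : ∀ w w' x y → restrict (w ++ w') x y ≡ restrict w x y ++ restrict w' x y
  restrict-++ w w' x y = begin
    restrict (w ++ w') x y                    ≡⟨ restrict-filter (w ++ w') x y ⟩
    filter (inPair? x y) (w ++ w')            ≡⟨ filter-++ (inPair? x y) w w' ⟩
    filter (inPair? x y) w ++ filter (inPair? x y) w'
      ≡⟨ cong₂ _++_ (restrict-filter w x y) (restrict-filter w' x y) ⟨
    restrict w x y ++ restrict w' x y         ∎

  restrict-swap : ∀ w x y → restrict w x y ≡ restrict w y x
  restrict-swap w x y = begin
    restrict w x y              ≡⟨ restrict-filter w x y ⟩
    filter (inPair? x y) w      ≡⟨ filter-≐ (inPair? x y) (inPair? y x) (Sum.swap , Sum.swap) w ⟩
    filter (inPair? y x) w      ≡⟨ restrict-filter w y x ⟨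
    restrict w y x              ∎

  restrict-keep : ∀ {c x y} w → InPair x y c → restrict (c ∷ w) x y ≡ c ∷ restrict w x y
  restrict-keep {c} {x} {y} w c∈xy = begin
    restrict (c ∷ w) x y          ≡⟨ restrict-filter (c ∷ w) x y ⟩
    filter (inPair? x y) (c ∷ w)  ≡⟨ filter-accept (inPair? x y) c∈xy ⟩
    c ∷ filter (inPair? x y) w    ≡⟨ cong (c ∷_) (restrict-filter w x y) ⟨
    c ∷ restrict w x y            ∎

  restrict-skip : ∀ {c x y} w → ¬ InPair x y c → restrict (c ∷ w) x y ≡ restrict w x y
  restrict-skip {c} {x} {y} w c∉xy = begin
    restrict (c ∷ w) x y          ≡⟨ restrict-filter (c ∷ w) x y ⟩
    filter (inPair? x y) (c ∷ w)  ≡⟨ filter-reject (inPair? x y) c∉xy ⟩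
    filter (inPair? x y) w        ≡⟨ restrict-filter w x y ⟨
    restrict w x y                ∎

  restrict-replicate-keep : ∀ {c x y} i → InPair x y c → restrict (replicate i c) x y ≡ replicate i c
  restrict-replicate-keep zero    c∈xy = refl
  restrict-replicate-keep (suc i) c∈xy = trans (restrict-keep _ c∈xy) (cong (_ ∷_) (restrict-replicate-keep i c∈xy))

  restrict-replicate-skip : ∀ {c x y} i → ¬ InPair x y c → restrict (replicate i c) x y ≡ []
  restrict-replicate-skip zero    c∉xy = refl
  restrict-replicate-skip (suc i) c∉xy = trans (restrict-skip _ c∉xy) (restrict-replicate-skip i c∉xy)

  restrict-concatMap : ∀ {B : Set} (f : B → List (Fin n)) l x y →
                       restrict (concatMap f l) x y ≡ concatMap (λ b → restrict (f b) x y) l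
  restrict-concatMap f []      x y = refl
  restrict-concatMap f (b ∷ l) x y =
    trans (restrict-++ (f b) (concatMap f l) x y) (cong (restrict (f b) x y ++_) (restrict-concatMap f l x y))

  omit : Fin n → List (Fin n) → List (Fin n)
  omit t = filter (λ c → ¬? (c ≟ t))

  omit-hit : ∀ {t} w → omit t (t ∷ w) ≡ omit t w
  omit-hit {t} w = filter-reject (λ c → ¬? (c ≟ t)) {xs = w} (λ t≢t → t≢t refl)

  omit-miss : ∀ {c t} w → c ≢ t → omit t (c ∷ w) ≡ c ∷ omit t w
  omit-miss {t = t} w c≢t = filter-accept (λ c → ¬? (c ≟ t)) {xs = w} c≢t

  restrict-omit : ∀ t w x y → restrict (omit t w) x y ≡ omit t (restrict w x y)
  restrict-omit t w x y = begin
    restrict (omit t w) x y                 ≡⟨ restrict-filter (omit t w) x y ⟩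
    filter (inPair? x y) (omit t w)         ≡⟨ filter-comm {P = InPair x y} {Q = λ c → c ≢ t} (inPair? x y) (λ c → ¬? (c ≟ t)) w ⟩
    omit t (filter (inPair? x y) w)         ≡⟨ cong (omit t) (restrict-filter w x y) ⟨
    omit t (restrict w x y)                 ∎

enum : (n : ℕ) → List (Fin n)
enum zero    = []
enum (suc n) = zero ∷ map suc (enum n)

∈-enum : ∀ {n} (v : Fin n) → v ∈ enum n
∈-enum zero    = here refl
∈-enum (suc v) = there (∈-map⁺ suc (∈-enum v))

module _ {n} {P : Pred (Fin (suc n)) 0ℓ} {R : Pred (Fin n) 0ℓ}
         (P? : Decidable P) (R? : Decidable R) (P∘suc≐R : (λ c → P (suc c)) ≐ R) where

  filter-enum-tail : filter P? (map suc (enum n)) ≡ map suc (filter R? (enum n))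
  filter-enum-tail =
    trans (filter-map P? suc (enum n)) (cong (map suc) (filter-≐ (λ c → P? (suc c)) R? P∘suc≐R (enum n)))

  filter-enum-accept : P zero → filter P? (enum (suc n)) ≡ zero ∷ map suc (filter R? (enum n))
  filter-enum-accept p0 = trans (filter-accept P? p0) (cong (zero ∷_) filter-enum-tail)

  filter-enum-reject : ¬ P zero → filter P? (enum (suc n)) ≡ map suc (filter R? (enum n))
  filter-enum-reject ¬p0 = trans (filter-reject P? ¬p0) filter-enum-tail

filter-enum-single : ∀ {n} (p : Fin n) → filter (_≟ p) (enum n) ≡ p ∷ []
filter-enum-single {suc n} zero =
  trans (filter-enum-accept (_≟ zero) ∅? ((λ ()) , λ ()) refl)
        (cong (λ l → zero ∷ map suc l) (filter-none ∅? {xs = enum n} (All.tabulate (λ _ ()))))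
filter-enum-single {suc n} (suc p) =
  trans (filter-enum-reject (_≟ suc p) (_≟ p) (suc-injective , cong suc) (λ ()))
        (cong (map suc) (filter-enum-single p))

filter-enum-pair : ∀ {n} (p q : Fin n) → p ≢ q →
                   filter (inPair? p q) (enum n) ≡ p ∷ q ∷ [] ⊎ filter (inPair? p q) (enum n) ≡ q ∷ p ∷ []
filter-enum-pair {suc n} zero zero p≢q = ⊥-elim (p≢q refl)
filter-enum-pair {suc n} zero (suc q) _ = inj₁ (
  trans (filter-enum-accept (inPair? zero (suc q)) (_≟ q) ([ (λ ()) , suc-injective ]′ , inj₂ ∘ cong suc) (inj₁ refl))
        (cong (λ l → zero ∷ map suc l) (filter-enum-single q)))
filter-enum-pair {suc n} (suc p) zero _ = inj₂ (
  trans (filter-enum-accept (inPair? (suc p) zero) (_≟ p) ([ suc-injective , (λ ()) ]′ , inj₁ ∘ cong suc) (inj₂ refl))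
        (cong (λ l → zero ∷ map suc l) (filter-enum-single p)))
filter-enum-pair {suc n} (suc p) (suc q) p≢q =
  Sum.map (trans shift ∘ cong (map suc)) (trans shift ∘ cong (map suc)) (filter-enum-pair p q (p≢q ∘ cong suc))
  where
  shift : filter (inPair? (suc p) (suc q)) (enum (suc n)) ≡ map suc (filter (inPair? p q) (enum n))
  shift = filter-enum-reject (inPair? (suc p) (suc q)) (inPair? p q)
            (Sum.map suc-injective suc-injective , Sum.map (cong suc) (cong suc)) [ (λ ()) , (λ ()) ]′

enum-order : ∀ {n} (x y : Fin n) → x ≢ y → restrict (enum n) x y ≡ x ∷ y ∷ [] ⊎ restrict (enum n) y x ≡ y ∷ x ∷ []
enum-order {n} x y x≢y with filter-enum-pair x y x≢y
... | inj₁ xy = inj₁ (trans (restrict-filter (enum n) x y) xy)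
... | inj₂ yx = inj₂ (trans (restrict-swap (enum n) y x) (trans (restrict-filter (enum n) x y) yx))

map-akb : ∀ {A : Set} (g : Bool → A) k → map g (akb (suc k)) ≡ g false ∷ replicate k (g false) ++ g true ∷ []
map-akb g k = trans (map-++ g (replicate (suc k) false) [ true ]) (cong (_++ [ g true ]) (map-replicate g (suc k) false))

occurrence-of-akb : ∀ {A : Set} {k} {w : List A} → Occurs (akb (suc k)) w →
                    Σ[ e ∈ A ] Σ[ f ∈ A ] Σ[ p ∈ List A ] Σ[ s ∈ List A ]
                      e ≢ f × w ≡ p ++ e ∷ replicate k e ++ f ∷ s
occurrence-of-akb {k = k} {w} (p , m , s , w≡pms , g , gakb≡m , g-inj) =
  g false , g true , p , s , a≢b , (begin
    w                                                         ≡⟨ w≡pms ⟩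
    p ++ m ++ s                                               ≡⟨ cong (λ m → p ++ m ++ s) (sym gakb≡m) ⟩
    p ++ map g (akb (suc k)) ++ s                             ≡⟨ cong (λ m → p ++ m ++ s) (map-akb g k) ⟩
    p ++ g false ∷ (replicate k (g false) ++ [ g true ]) ++ s
      ≡⟨ cong (λ t → p ++ g false ∷ t) (++-assoc (replicate k (g false)) [ g true ] s) ⟩
    p ++ g false ∷ replicate k (g false) ++ g true ∷ s        ∎)
  where
  a≢b : g false ≢ g true
  a≢b ga≡gb with g-inj false true (here refl) (∈-++⁺ʳ (replicate (suc k) false) (here refl)) ga≡gb
  ... | ()

occurs-akb : ∀ {A : Set} {k e f} (p s : List A) → e ≢ f → Occurs (akb (suc k)) (p ++ (e ∷ replicate k e ++ f ∷ []) ++ s)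
occurs-akb {k = k} {e} {f} p s e≢f = p , _ , s , refl , g , map-akb g k , g-inj
  where
  g : Bool → _
  g false = e
  g true  = f
  g-inj : ∀ a b → a ∈ akb (suc k) → b ∈ akb (suc k) → g a ≡ g b → a ≡ b
  g-inj false false _ _ _   = refl
  g-inj true  true  _ _ _   = refl
  g-inj false true  _ _ e≡f = ⊥-elim (e≢f e≡f)
  g-inj true  false _ _ f≡e = ⊥-elim (e≢f (sym f≡e))

replicate-snoc : ∀ {A : Set} i (c : A) w → replicate i c ++ c ∷ w ≡ c ∷ replicate i c ++ w
replicate-snoc zero    c w = refl
replicate-snoc (suc i) c w = cong (c ∷_) (replicate-snoc i c w)

module Runs {A : Set} (K : ℕ) where

  -- Safe j c w: the word w, read after a run of j copies of c, never ends a run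
  -- of K or more equal letters by switching to a different letter.
  data Safe : ℕ → A → List A → Set where
    done   : ∀ {j c} → Safe j c []
    extend : ∀ {j c w} → Safe (suc j) c w → Safe j c (c ∷ w)
    switch : ∀ {j c d w} → d ≢ c → j < K → Safe 1 d w → Safe j c (d ∷ w)

  safe-weaken : ∀ {i j c w} → i ≤ j → Safe j c w → Safe i c w
  safe-weaken i≤j done               = done
  safe-weaken i≤j (extend safe)      = extend (safe-weaken (s≤s i≤j) safe)
  safe-weaken i≤j (switch d≢c j<K safe) = switch d≢c (≤-<-trans i≤j j<K) safe

  safe-replicate : ∀ i {j c w} → Safe (i + j) c w → Safe j c (replicate i c ++ w)
  safe-replicate zero    safe = safe
  safe-replicate (suc i) {j} {c} {w} safe = extend (safe-replicate i (subst (λ l → Safe l c w) (sym (+-suc i j)) safe))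

  switch-run : ∀ {i j c d w} → d ≢ c → j < K → Safe (suc i) d w → Safe j c (replicate (suc i) d ++ w)
  switch-run {i} {d = d} {w} d≢c j<K safe = switch d≢c j<K (safe-replicate i (subst (λ l → Safe l d w) (+-comm 1 i) safe))

  long-run-unsafe : ∀ i {j e f s} → e ≢ f → K ≤ i + j → Safe j e (replicate i e ++ f ∷ s) → ⊥
  long-run-unsafe zero    e≢f K≤j (extend _)          = e≢f refl
  long-run-unsafe zero    e≢f K≤j (switch _ j<K _)    = <⇒≱ j<K K≤j
  long-run-unsafe (suc i) {j} e≢f K≤ (extend safe)    = long-run-unsafe i e≢f (subst (K ≤_) (sym (+-suc i j)) K≤) safe
  long-run-unsafe (suc i) e≢f K≤ (switch e≢e _ _)     = e≢e refl

  run-bound : ∀ i j → K ≤ suc i → K ≤ i + suc j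
  run-bound i j K≤ = ≤-trans K≤ (subst (suc i ≤_) (sym (+-suc i j)) (s≤s (m≤m+n i j)))

  unsafe-factor : ∀ p i {j c e f s} → e ≢ f → K ≤ suc i → Safe j c (p ++ e ∷ replicate i e ++ f ∷ s) → ⊥
  unsafe-factor []      i {j} e≢f K≤ (extend safe) = long-run-unsafe i e≢f (run-bound i j K≤) safe
  unsafe-factor []      i e≢f K≤ (switch _ _ safe) = long-run-unsafe i e≢f (run-bound i 0 K≤) safe
  unsafe-factor (d ∷ p) i e≢f K≤ (extend safe)     = unsafe-factor p i e≢f K≤ safe
  unsafe-factor (d ∷ p) i e≢f K≤ (switch _ _ safe) = unsafe-factor p i e≢f K≤ safe

-- For K ≥ 3 robustness is
-- preserved by prefixing the short words that arise as restrictions of the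
-- blocks of the construction; robust words avoid a^k b for k ≥ K.
module Robustness {A : Set} (_≟_ : DecidableEquality A) {K : ℕ} (3≤K : 3 ≤ K) where
  open Runs {A} K public

  Robust : List A → Set
  Robust w = ∀ c → Safe 1 c w

  Extends : List A → Set
  Extends r = ∀ w → Robust w → Robust (r ++ w)

  1<K : 1 < K
  1<K = ≤-trans (s≤s (s≤s z≤n)) 3≤K

  2<K : 2 < K
  2<K = 3≤K

  robust-[] : Robust []
  robust-[] c = done

  robust-cons : ∀ {d w} → Safe 2 d w → Robust (d ∷ w)
  robust-cons {d} safe c with c ≟ d
  ... | yes refl = extend safe
  ... | no  c≢d  = switch (≢-sym c≢d) 1<K (safe-weaken (s≤s z≤n) safe)

  robust-avoids : ∀ {k w} → K ≤ suc k → Robust w → Avoids w (akb (suc k))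
  robust-avoids {k} K≤ robust occ with occurrence-of-akb occ
  ... | e , f , p , s , e≢f , w≡ = unsafe-factor p k e≢f K≤ (subst (Safe 1 e) w≡ (robust e))

  extends-++ : ∀ {r r'} → Extends r → Extends r' → Extends (r ++ r')
  extends-++ {r} {r'} ext ext' w robust =
    subst Robust (sym (++-assoc r r' w)) (ext (r' ++ w) (ext' w robust))

  extends-concatMap : ∀ {B : Set} (f : B → List A) (l : List B) →
                      (∀ {b} → b ∈ l → Extends (f b)) → Extends (concatMap f l)
  extends-concatMap f []      ext w robust = robust
  extends-concatMap f (b ∷ l) ext = extends-++ {f b} (ext (here refl)) (extends-concatMap f l (ext ∘ there))

  -- d e with d ≠ e: at most a run d d of length 2 occurs before the switch to e.
  extends-pair : ∀ {d e} → d ≢ e → Extends (d ∷ e ∷ [])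
  extends-pair {e = e} d≢e w robust = robust-cons (switch (≢-sym d≢e) 2<K (robust e))

  -- z x^(i+1) z x: its only long run is x^(i+1), which is shorter than K.
  extends-spike : ∀ {z x i} → z ≢ x → suc i < K → Extends (z ∷ replicate (suc i) x ++ z ∷ x ∷ [])
  extends-spike {z} {x} {i} z≢x i<K w robust =
    subst Robust (cong (z ∷_) (sym (++-assoc (replicate (suc i) x) (z ∷ x ∷ []) w)))
      (robust-cons (switch-run (≢-sym z≢x) 2<K (switch z≢x i<K (switch (≢-sym z≢x) 1<K (robust x)))))

module Construction (m : ℕ) {n : ℕ} (G : SimpleGraph n) where
  open SimpleGraph G using (Adj) renaming (sym to Adj-sym)

  -- Blocks use runs of length r = k - 1.
  r : ℕ
  r = suc (suc m)

  open Robustness {Fin n} _≟_ {suc r} (s≤s (s≤s (s≤s z≤n)))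

  π : List (Fin n)
  π = enum n

  -- The block of the non-edge (x, y); restricted to {x,y} it is y x^k y.
  block : Fin n → Fin n → List (Fin n)
  block x y = omit x π ++ replicate r x ++ omit y (omit x π) ++ x ∷ y ∷ []

  NonEdge : Pred (Fin n × Fin n) 0ℓ
  NonEdge (x , y) = x ≢ y × Adj x y ≡ false

  nonEdge? : Decidable NonEdge
  nonEdge? (x , y) = ¬? (x ≟ y) ×-dec (Adj x y Bool.≟ false)

  nonEdges : List (Fin n × Fin n)
  nonEdges = filter nonEdge? (cartesianProduct π π)

  blockAt : Fin n × Fin n → List (Fin n)
  blockAt (x , y) = block x y

  -- The representing word: all blocks, then π so that every vertex occurs.
  word : List (Fin n)
  word = concatMap blockAt nonEdges ++ π

  ∈-word : ∀ v → v ∈ word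
  ∈-word v = ∈-++⁺ʳ (concatMap blockAt nonEdges) (∈-enum v)

  edge≢nonEdge : ∀ {x y} → Adj x y ≡ true → Adj x y ≡ false → ⊥
  edge≢nonEdge edge nonEdge with trans (sym edge) nonEdge
  ... | ()

  module Pair (u v : Fin n) (u≢v : u ≢ v) (π|uv : restrict π u v ≡ u ∷ v ∷ []) where
    res : List (Fin n) → List (Fin n)
    res w = restrict w u v

    v≢u : v ≢ u
    v≢u = ≢-sym u≢v

    res-u : ∀ w → res (u ∷ w) ≡ u ∷ res w
    res-u w = restrict-keep w (inj₁ refl)

    res-v : ∀ w → res (v ∷ w) ≡ v ∷ res w
    res-v w = restrict-keep w (inj₂ refl)

    res-out : ∀ {x} w → x ≢ u → x ≢ v → res (x ∷ w) ≡ res w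
    res-out w x≢u x≢v = restrict-skip w [ x≢u , x≢v ]′

    omit-u : omit u (u ∷ v ∷ []) ≡ v ∷ []
    omit-u = trans (omit-hit (v ∷ [])) (omit-miss [] v≢u)

    omit-v : omit v (u ∷ v ∷ []) ≡ u ∷ []
    omit-v = trans (omit-miss (v ∷ []) u≢v) (cong (u ∷_) (omit-hit {t = v} []))

    omit-out : ∀ {x} → x ≢ u → x ≢ v → omit x (u ∷ v ∷ []) ≡ u ∷ v ∷ []
    omit-out x≢u x≢v = trans (omit-miss (v ∷ []) (≢-sym x≢u)) (cong (u ∷_) (omit-miss [] (≢-sym x≢v)))

    restrict-block : ∀ {x y a b c d} → omit x (u ∷ v ∷ []) ≡ a → res (replicate r x) ≡ b →
                     omit y a ≡ c → res (x ∷ y ∷ []) ≡ d → res (block x y) ≡ a ++ b ++ c ++ d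
    restrict-block {x} {y} {b = b} {d = d} refl b-eq refl d-eq = begin
      res (omit x π ++ replicate r x ++ omit y (omit x π) ++ x ∷ y ∷ [])
        ≡⟨ restrict-++ (omit x π) _ u v ⟩
      res (omit x π) ++ res (replicate r x ++ omit y (omit x π) ++ x ∷ y ∷ [])
        ≡⟨ cong (res (omit x π) ++_) (restrict-++ (replicate r x) _ u v) ⟩
      res (omit x π) ++ res (replicate r x) ++ res (omit y (omit x π) ++ x ∷ y ∷ [])
        ≡⟨ cong (λ z → res (omit x π) ++ res (replicate r x) ++ z) (restrict-++ (omit y (omit x π)) _ u v) ⟩
      res (omit x π) ++ res (replicate r x) ++ res (omit y (omit x π)) ++ res (x ∷ y ∷ [])
        ≡⟨ cong₂ _++_ res-omit-π (cong₂ _++_ b-eq (cong₂ _++_ res-omit-omit-π d-eq)) ⟩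
      omit x (u ∷ v ∷ []) ++ b ++ omit y (omit x (u ∷ v ∷ [])) ++ d ∎
      where
      res-omit-π : res (omit x π) ≡ omit x (u ∷ v ∷ [])
      res-omit-π = trans (restrict-omit x π u v) (cong (omit x) π|uv)
      res-omit-omit-π : res (omit y (omit x π)) ≡ omit y (omit x (u ∷ v ∷ []))
      res-omit-omit-π = trans (restrict-omit y (omit x π) u v) (cong (omit y) res-omit-π)

    block-from-u : ∀ {y} → y ≢ u → y ≢ v → res (block u y) ≡ v ∷ replicate r u ++ v ∷ u ∷ []
    block-from-u {y} y≢u y≢v = restrict-block omit-u (restrict-replicate-keep r (inj₁ refl))
      (omit-miss [] (≢-sym y≢v)) (trans (res-u (y ∷ [])) (cong (u ∷_) (res-out [] y≢u y≢v)))

    block-from-v : ∀ {y} → y ≢ u → y ≢ v → res (block v y) ≡ u ∷ replicate r v ++ u ∷ v ∷ []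
    block-from-v {y} y≢u y≢v = restrict-block omit-v (restrict-replicate-keep r (inj₂ refl))
      (omit-miss [] (≢-sym y≢u)) (trans (res-v (y ∷ [])) (cong (v ∷_) (res-out [] y≢u y≢v)))

    block-into-u : ∀ {x} → x ≢ u → x ≢ v → res (block x u) ≡ u ∷ v ∷ v ∷ u ∷ []
    block-into-u x≢u x≢v = restrict-block (omit-out x≢u x≢v) (restrict-replicate-skip r [ x≢u , x≢v ]′)
      omit-u (trans (res-out (u ∷ []) x≢u x≢v) (res-u []))

    block-into-v : ∀ {x} → x ≢ u → x ≢ v → res (block x v) ≡ u ∷ v ∷ u ∷ v ∷ []
    block-into-v x≢u x≢v = restrict-block (omit-out x≢u x≢v) (restrict-replicate-skip r [ x≢u , x≢v ]′)
      omit-v (trans (res-out (v ∷ []) x≢u x≢v) (res-v []))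

    block-outside : ∀ {x y} → x ≢ u → x ≢ v → y ≢ u → y ≢ v → res (block x y) ≡ u ∷ v ∷ u ∷ v ∷ []
    block-outside x≢u x≢v y≢u y≢v = restrict-block (omit-out x≢u x≢v) (restrict-replicate-skip r [ x≢u , x≢v ]′)
      (omit-out y≢u y≢v) (trans (res-out (_ ∷ []) x≢u x≢v) (res-out [] y≢u y≢v))

    block-uv : res (block u v) ≡ v ∷ u ∷ replicate r u ++ v ∷ []
    block-uv = trans (restrict-block omit-u (restrict-replicate-keep r (inj₁ refl)) (omit-hit {t = v} [])
                       (trans (res-u (v ∷ [])) (cong (u ∷_) (res-v []))))
                     (cong (v ∷_) (replicate-snoc r u (v ∷ [])))

    block-extends : ∀ {x y} → x ≢ y → ¬ (x ≡ u × y ≡ v) → ¬ (x ≡ v × y ≡ u) → Extends (res (block x y))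
    block-extends {x} {y} x≢y not-uv not-vu with x ≟ u | x ≟ v
    ... | yes refl | _ = subst Extends (sym (block-from-u (≢-sym x≢y) (λ y≡v → not-uv (refl , y≡v))))
                                (extends-spike v≢u ≤-refl)
    ... | no _ | yes refl = subst Extends (sym (block-from-v (λ y≡u → not-vu (refl , y≡u)) (≢-sym x≢y)))
                                  (extends-spike u≢v ≤-refl)
    ... | no x≢u | no x≢v with y ≟ u | y ≟ v
    ...   | yes refl | _ = subst Extends (sym (block-into-u x≢u x≢v))
                                 (extends-++ {u ∷ v ∷ []} (extends-pair u≢v) (extends-pair v≢u))
    ...   | no _ | yes refl = subst Extends (sym (block-into-v x≢u x≢v))
                                    (extends-++ {u ∷ v ∷ []} (extends-pair u≢v) (extends-pair u≢v))
    ...   | no y≢u | no y≢v = subst Extends (sym (block-outside x≢u x≢v y≢u y≢v))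
                                    (extends-++ {u ∷ v ∷ []} (extends-pair u≢v) (extends-pair u≢v))

    res-word : res word ≡ concatMap (res ∘ blockAt) nonEdges ++ u ∷ v ∷ []
    res-word = trans (restrict-++ (concatMap blockAt nonEdges) π u v)
                     (cong₂ _++_ (restrict-concatMap blockAt nonEdges u v) π|uv)

    edge-robust : Adj u v ≡ true → Robust (res word)
    edge-robust edge = subst Robust (sym res-word)
      (extends-concatMap (res ∘ blockAt) nonEdges nonEdge-extends (u ∷ v ∷ []) (extends-pair u≢v [] robust-[]))
      where
      nonEdge-extends : ∀ {b} → b ∈ nonEdges → Extends (res (blockAt b))
      nonEdge-extends {x , y} b∈ with proj₂ (∈-filter⁻ nonEdge? {xs = cartesianProduct π π} b∈)
      ... | x≢y , nonEdge = block-extends x≢y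
        (λ { (refl , refl) → edge≢nonEdge edge nonEdge })
        (λ { (refl , refl) → edge≢nonEdge edge (trans (Adj-sym u v) nonEdge) })

    uv∈nonEdges : Adj u v ≡ false → (u , v) ∈ nonEdges
    uv∈nonEdges nonEdge =
      ∈-filter⁺ nonEdge? {xs = cartesianProduct π π} (∈-cartesianProduct⁺ (∈-enum u) (∈-enum v)) (u≢v , nonEdge)

    nonEdge-occurs : Adj u v ≡ false → Occurs (akb (suc r)) (res word)
    nonEdge-occurs nonEdge with ∈-∃++ (uv∈nonEdges nonEdge)
    ... | before , after , nonEdges≡ =
      subst (Occurs (akb (suc r))) (sym res-word≡) (occurs-akb {k = r} (res P ++ v ∷ []) (res S) u≢v)
      where
      P S : List (Fin n)
      P = concatMap blockAt before
      S = concatMap blockAt after ++ π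
      word≡ : word ≡ P ++ block u v ++ S
      word≡ = begin
        concatMap blockAt nonEdges ++ π
          ≡⟨ cong (λ l → concatMap blockAt l ++ π) nonEdges≡ ⟩
        concatMap blockAt (before ++ (u , v) ∷ after) ++ π
          ≡⟨ cong (_++ π) (concatMap-++ blockAt before ((u , v) ∷ after)) ⟩
        (P ++ block u v ++ concatMap blockAt after) ++ π
          ≡⟨ ++-assoc P _ π ⟩
        P ++ (block u v ++ concatMap blockAt after) ++ π
          ≡⟨ cong (P ++_) (++-assoc (block u v) _ π) ⟩
        P ++ block u v ++ S ∎
      res-word≡ : res word ≡ (res P ++ v ∷ []) ++ (u ∷ replicate r u ++ v ∷ []) ++ res S
      res-word≡ = begin
        res word                              ≡⟨ cong res word≡ ⟩
        res (P ++ block u v ++ S)             ≡⟨ restrict-++ P _ u v ⟩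
        res P ++ res (block u v ++ S)         ≡⟨ cong (res P ++_) (restrict-++ (block u v) S u v) ⟩
        res P ++ res (block u v) ++ res S     ≡⟨ cong (λ b → res P ++ b ++ res S) block-uv ⟩
        res P ++ v ∷ (u ∷ replicate r u ++ v ∷ []) ++ res S
          ≡⟨ ++-assoc (res P) (v ∷ []) _ ⟨
        (res P ++ v ∷ []) ++ (u ∷ replicate r u ++ v ∷ []) ++ res S ∎

    represents : (Adj u v ≡ true) ⇔ Avoids (res word) (akb (suc r))
    represents = mk⇔ (robust-avoids ≤-refl ∘ edge-robust) edge-if-avoids
      where
      edge-if-avoids : Avoids (res word) (akb (suc r)) → Adj u v ≡ true
      edge-if-avoids avoids with Adj u v in uv-adj
      ... | true  = refl
      ... | false = ⊥-elim (avoids (nonEdge-occurs uv-adj))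

  representation : Representable (akb (suc r)) G
  representation = word , ∈-word , represents-pair
    where
    represents-pair : ∀ x y → x ≢ y → (Adj x y ≡ true) ⇔ Avoids (restrict word x y) (akb (suc r))
    represents-pair x y x≢y with enum-order x y x≢y
    ... | inj₁ π|xy = Pair.represents x y x≢y π|xy
    ... | inj₂ π|yx = subst₂ (λ a w → (a ≡ true) ⇔ Avoids w (akb (suc r))) (Adj-sym y x) (restrict-swap word y x)
                             (Pair.represents y x (≢-sym x≢y) π|yx)

theorem9 : (k : ℕ) → 3 ≤ k → (n : ℕ) (G : SimpleGraph n) → Representable (akb k) G
theorem9 (suc (suc (suc m))) (s≤s (s≤s (s≤s z≤n))) n G = Construction.representation m G
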